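{- Let $P$ be a finite poset with set of cover relations $C=\{(x,y)\in P\times P: x\lessdot y\}$, and let $C=G\sqcup B$ be an acyclic partition of $C$. Call an increasing sequence $\mathcal{I}=(\emptyset=I_0\subsetneq I_1\subsetneq\cdots\subsetneq I_\ell=P)$ of order ideals of $P$ a $G$-sequence if for every $i=1,\ldots,\ell$, whenever $x,y\in I_i\setminus I_{i-1}$ and $x\lessdot y$ we have $(x,y)\in G$; its length is $|\mathcal{I}|=\ell$. Then $$\sum_{\mathcal{I}\text{ a }G\text{ -sequence}}(-1)^{|\mathcal{I}|}=\begin{cases}(-1)^{|P|}&\text{if }G=\emptyset,\\ 0&\text{otherwise.}\end{cases}$$
   Context: An order ideal of $P$ is a down-closed subset. A partition $C=G\sqcup B$ of the cover relations of $P$ is called acyclic if the directed graph on the Hasse diagram of $P$ obtained by orienting each cover relation $(x,y)\in G$ upward (from $x$ to $y$) and each cover relation $(x,y)\in B$ downward (from $y$ to $x$) has no directed cycle. -}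

module Defs where

open import Level using (0ℓ)
open import Data.Nat using (ℕ; _∸_)
open import Data.Integer as ℤ using (ℤ; -1ℤ; 0ℤ; _+_; _^_)
open import Data.Fin using (Fin)
open import Data.Fin.Subset using (Subset; _∈_; _∉_; _⊂_; ⊥; ⊤)
open import Data.List using (List; []; _∷_; length; head; last; map; foldr)
open import Data.List.Relation.Unary.All using (All)
open import Data.List.Relation.Unary.Linked using (Linked)
open import Data.Maybe using (just)
open import Data.Product using (_×_)
open import Data.Sum using (_⊎_)
open import Relation.Nullary using (¬_)
open import Relation.Binary using (Rel; IsDecPartialOrder)
open import Relation.Binary.PropositionalEquality using (_≡_; _≢_)
open import Relation.Binary.Construct.Closure.Transitive using (TransClosure)

module _ {n : ℕ} (_≼_ : Rel (Fin n) 0ℓ) where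

  Covers : Fin n → Fin n → Set
  Covers x y = (x ≼ y) × (x ≢ y) × (∀ z → x ≼ z → z ≼ y → (z ≡ x) ⊎ (z ≡ y))

  IsOrderIdeal : Subset n → Set
  IsOrderIdeal I = ∀ x y → y ∈ I → x ≼ y → x ∈ I

  module _ (G : Fin n → Fin n → Set) where

    GSubCovers : Set
    GSubCovers = ∀ x y → G x y → Covers x y

    InB : Fin n → Fin n → Set
    InB x y = Covers x y × ¬ G x y

    -- oriented Hasse diagram: G-covers upward, B-covers downward
    Edge : Fin n → Fin n → Set
    Edge u v = (G u v) ⊎ (InB v u)

    IsAcyclic : Set
    IsAcyclic = ∀ u → ¬ TransClosure Edge u u

    GStep : Subset n → Subset n → Set
    GStep J I = (J ⊂ I) ×
      (∀ x y → x ∈ I → x ∉ J → y ∈ I → y ∉ J → Covers x y → G x y)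

    -- a G-sequence, represented as the list [I_0, I_1, ..., I_ℓ]
    IsGSequence : List (Subset n) → Set
    IsGSequence L = (head L ≡ just ⊥) × (last L ≡ just ⊤)
                  × All IsOrderIdeal L × Linked GStep L

-- length ℓ of a sequence represented as [I_0, ..., I_ℓ]
seqLength : ∀ {n} → List (Subset n) → ℕ
seqLength L = length L ∸ 1

sumℤ : List ℤ → ℤ
sumℤ = foldr _+_ 0ℤ

signedSum : ∀ {n} → List (List (Subset n)) → ℤ
signedSum Ls = sumℤ (map (λ L → -1ℤ ^ seqLength L) Ls)

module Submission where

-- Let Y(J) be the signed number of chains J = I₀ ⊊ ⋯ ⊊ I_ℓ = P of ideals with G-steps, so
-- that the theorem is about Y(∅). Splitting off the first step gives Y(J) = [J = P] − Σ Y(K)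
-- over the G-steps J ⊊ K, and by induction Y(J) = (−1)^|P∖J| if no G-cover lies in P∖J and
-- Y(J) = 0 otherwise. For the induction step pick a sink e of the oriented Hasse diagram
-- restricted to P∖J, which exists by acyclicity. Adding or removing e preserves the family of
-- ideals K ⊇ J whose covers inside K∖J are all in G and whose complement contains no G-cover,
-- so the signed count of this family vanishes. Its term K = J is (−1)^|P∖J| or 0 according to
-- whether P∖J contains a G-cover, and the remaining terms add up to Σ Y(K).

open import Defs
open import Level using (0ℓ)
open import Data.Bool using (Bool; true; false; if_then_else_; _∧_; _∨_; not)
import Data.Bool.Properties as Bool
open import Data.Fin using (Fin; zero; suc)
open import Data.Fin.Induction using (po-wellFounded; po-noetherian; spo-noetherian)
import Data.Fin.Properties as Fin
open import Data.Fin.Properties using (any?; all?)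
open import Data.Fin.Subset using (Subset; inside; outside; _⊆_; _⊂_; ⊤; ⊥; ∁; ∣_∣)
  renaming (_∈_ to _∈ₛ_; _∉_ to _∉ₛ_)
open import Data.Fin.Subset.Properties
  using (_⊆?_; ⊆-antisym; ∈⊤; ∉⊥; ⊆⊤; p⊂q⇒∣p∣<∣q∣; p⊂q⇒∁p⊃∁q) renaming (_∈?_ to _∈ₛ?_)
open import Data.Integer using (ℤ; -1ℤ; 0ℤ; 1ℤ; _+_; _-_; -_; _*_; _^_)
import Data.Integer.Properties as ℤ
open import Algebra.Properties.CommutativeSemigroup ℤ.+-commutativeSemigroup using (interchange)
open import Data.List using (List; []; _∷_; length; map; last)
import Data.List.Properties as List
open import Data.List.Membership.Propositional using (_∈_)
open import Data.List.Relation.Unary.All using (All; []; _∷_)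
open import Data.List.Relation.Unary.AllPairs using (_∷_)
open import Data.List.Relation.Unary.Any using (here; there)
open import Data.List.Relation.Unary.Linked using (Linked; [-]; _∷_)
open import Data.List.Relation.Unary.Unique.Propositional using (Unique)
open import Data.List.Relation.Unary.Unique.Propositional.Properties using (Unique[x∷xs]⇒x∉xs)
open import Data.Maybe using (just)
open import Data.Maybe.Properties using (just-injective)
open import Data.Nat using (ℕ; zero; suc; _<_; _≤_; s≤s; z≤n)
import Data.Nat.Properties as ℕ
open import Data.Product using (_×_; _,_; proj₁; proj₂; ∃)
open import Data.Sum using (_⊎_; inj₁; inj₂)
open import Data.Vec using ([]; _∷_; _[_]≔_)
import Data.Vec.Properties as Vec
open import Function using (_∘_; flip)
open import Function.Bundles using (_⇔_; mk⇔; Equivalence)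
import Function.Properties.Equivalence as ⇔
open import Induction.WellFounded using (WellFounded; Acc; acc; module Subrelation)
open import Relation.Binary using (Rel; IsDecPartialOrder; IsStrictPartialOrder)
import Relation.Binary as B
open import Relation.Binary.Construct.Closure.Transitive using (TransClosure; [_]; _++_)
open import Relation.Binary.PropositionalEquality
  using (_≡_; _≢_; refl; sym; trans; cong; cong₂; subst; resp₂; isEquivalence; module ≡-Reasoning)
open import Relation.Nullary using (¬_; Dec; yes; no; does; contradiction; ¬?; _×-dec_; _⊎-dec_; _→-dec_)
import Relation.Nullary.Decidable as Dec
open import Relation.Nullary.Decidable using (does-⇔; dec-true; dec-false; decidable-stable)
open import Relation.Unary using (Pred; Decidable)

private variable
  n : ℕ

_≟ₛ_ : (J K : Subset n) → Dec (J ≡ K)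
_≟ₛ_ = Vec.≡-dec Bool._≟_

_≟ₗ_ : (L M : List (Subset n)) → Dec (L ≡ M)
_≟ₗ_ = List.≡-dec _≟ₛ_

infixl 7 _when_
_when_ : ℤ → Bool → ℤ
x when b = if b then x else 0ℤ

when-∧ : ∀ x a b → x when (a ∧ b) ≡ (x when b) when a
when-∧ x true  b = refl
when-∧ x false b = refl

when-neg : ∀ x b → (- x) when b ≡ - (x when b)
when-neg x true  = refl
when-neg x false = refl

when-∨ : ∀ x a b → ¬ (a ≡ true × b ≡ true) → (x when a) + (x when b) ≡ x when (a ∨ b)
when-∨ x true  true  disjoint = contradiction (refl , refl) disjoint
when-∨ x true  false _ = ℤ.+-identityʳ x
when-∨ x false b     _ = ℤ.+-identityˡ (x when b)

∑ₛ : (Subset n → ℤ) → ℤ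
∑ₛ {zero}  f = f []
∑ₛ {suc n} f = ∑ₛ (f ∘ (inside ∷_)) + ∑ₛ (f ∘ (outside ∷_))

∑ₛ-cong : {f g : Subset n → ℤ} → (∀ K → f K ≡ g K) → ∑ₛ f ≡ ∑ₛ g
∑ₛ-cong {zero}  f≗g = f≗g []
∑ₛ-cong {suc n} f≗g = cong₂ _+_ (∑ₛ-cong (f≗g ∘ (inside ∷_))) (∑ₛ-cong (f≗g ∘ (outside ∷_)))

∑ₛ-zero : ∑ₛ {n} (λ _ → 0ℤ) ≡ 0ℤ
∑ₛ-zero {zero}  = refl
∑ₛ-zero {suc n} = cong₂ _+_ (∑ₛ-zero {n}) (∑ₛ-zero {n})

∑ₛ-+ : (f g : Subset n → ℤ) → ∑ₛ (λ K → f K + g K) ≡ ∑ₛ f + ∑ₛ g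
∑ₛ-+ {zero}  f g = refl
∑ₛ-+ {suc n} f g = trans
  (cong₂ _+_ (∑ₛ-+ (f ∘ (inside ∷_)) (g ∘ (inside ∷_))) (∑ₛ-+ (f ∘ (outside ∷_)) (g ∘ (outside ∷_))))
  (interchange (∑ₛ (f ∘ (inside ∷_))) _ _ _)

∑ₛ-neg : (f : Subset n → ℤ) → ∑ₛ (λ K → - f K) ≡ - ∑ₛ f
∑ₛ-neg {zero}  f = refl
∑ₛ-neg {suc n} f = trans
  (cong₂ _+_ (∑ₛ-neg (f ∘ (inside ∷_))) (∑ₛ-neg (f ∘ (outside ∷_))))
  (sym (ℤ.neg-distrib-+ (∑ₛ (f ∘ (inside ∷_))) _))

∑ₛ-delta : (k : Subset n) (f : Subset n → ℤ) → ∑ₛ (λ K → f K when does (K ≟ₛ k)) ≡ f k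
∑ₛ-delta []              f = refl
∑ₛ-delta {suc n} (inside  ∷ k) f =
  trans (cong₂ _+_ (∑ₛ-delta k (f ∘ (inside ∷_))) (∑ₛ-zero {n})) (ℤ.+-identityʳ _)
∑ₛ-delta {suc n} (outside ∷ k) f =
  trans (cong₂ _+_ (∑ₛ-zero {n}) (∑ₛ-delta k (f ∘ (outside ∷_)))) (ℤ.+-identityˡ _)

∑ₛ-antisymmetric : (e : Fin n) (f : Subset n → ℤ) →
  (∀ K → f (K [ e ]≔ inside) ≡ - f (K [ e ]≔ outside)) → ∑ₛ f ≡ 0ℤ
∑ₛ-antisymmetric {suc n} zero f anti = trans
  (cong (_+ ∑ₛ (f ∘ (outside ∷_))) (trans (∑ₛ-cong (anti ∘ (inside ∷_))) (∑ₛ-neg (f ∘ (outside ∷_)))))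
  (ℤ.+-inverseˡ (∑ₛ (f ∘ (outside ∷_))))
∑ₛ-antisymmetric {suc n} (suc e) f anti = cong₂ _+_
  (∑ₛ-antisymmetric e (f ∘ (inside ∷_)) (anti ∘ (inside ∷_)))
  (∑ₛ-antisymmetric e (f ∘ (outside ∷_)) (anti ∘ (outside ∷_)))

sign : ∀ {n} → Subset n → ℤ
sign K = -1ℤ ^ ∣ ∁ K ∣

∣∁[e]≔outside∣ : (e : Fin n) (K : Subset n) → ∣ ∁ (K [ e ]≔ outside) ∣ ≡ suc ∣ ∁ (K [ e ]≔ inside) ∣
∣∁[e]≔outside∣ zero    (_ ∷ K)       = refl
∣∁[e]≔outside∣ (suc e) (inside  ∷ K) = ∣∁[e]≔outside∣ e K
∣∁[e]≔outside∣ (suc e) (outside ∷ K) = cong suc (∣∁[e]≔outside∣ e K)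

∣∁⊤∣≡0 : ∀ n → ∣ ∁ (⊤ {n}) ∣ ≡ 0
∣∁⊤∣≡0 zero    = refl
∣∁⊤∣≡0 (suc n) = ∣∁⊤∣≡0 n

∣∁⊥∣≡n : ∀ n → ∣ ∁ (⊥ {n}) ∣ ≡ n
∣∁⊥∣≡n zero    = refl
∣∁⊥∣≡n (suc n) = cong suc (∣∁⊥∣≡n n)

signedCount : ∀ {ℓ} {P : Pred (Subset n) ℓ} → Decidable P → ℤ
signedCount P? = ∑ₛ λ K → sign K when does (P? K)

module _ {ℓ} {P : Pred (Subset n) ℓ} where

  signedCount-cong : ∀ {ℓ′} {Q : Pred (Subset n) ℓ′} (P? : Decidable P) (Q? : Decidable Q) →
    (∀ K → P K ⇔ Q K) → signedCount P? ≡ signedCount Q?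
  signedCount-cong P? Q? P⇔Q = ∑ₛ-cong λ K → cong (λ b → sign K when b) (does-⇔ (P⇔Q K) (P? K) (Q? K))

  signedCount-extract : (P? : Decidable P) (J : Subset n) →
    signedCount P? ≡ sign J when does (P? J) + signedCount (λ K → ¬? (K ≟ₛ J) ×-dec P? K)
  signedCount-extract P? J = begin
    ∑ₛ (λ K → sign K when does (P? K))
      ≡⟨ ∑ₛ-cong split ⟩
    ∑ₛ (λ K → sign K when does (P? K) when does (K ≟ₛ J) + rest K)
      ≡⟨ ∑ₛ-+ (λ K → sign K when does (P? K) when does (K ≟ₛ J)) rest ⟩
    ∑ₛ (λ K → sign K when does (P? K) when does (K ≟ₛ J)) + ∑ₛ rest
      ≡⟨ cong (_+ ∑ₛ rest) (∑ₛ-delta J (λ K → sign K when does (P? K))) ⟩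
    sign J when does (P? J) + ∑ₛ rest ∎
    where
    open ≡-Reasoning
    rest : Subset n → ℤ
    rest K = sign K when (not (does (K ≟ₛ J)) ∧ does (P? K))
    split : ∀ K → sign K when does (P? K) ≡ sign K when does (P? K) when does (K ≟ₛ J) + rest K
    split K with does (K ≟ₛ J)
    ... | true  = sym (ℤ.+-identityʳ _)
    ... | false = sym (ℤ.+-identityˡ _)

  signedCount-toggle : (P? : Decidable P) (e : Fin n) →
    (∀ K → P (K [ e ]≔ inside) ⇔ P (K [ e ]≔ outside)) → signedCount P? ≡ 0ℤ
  signedCount-toggle P? e toggle = ∑ₛ-antisymmetric e _ λ K →
    trans (cong (λ b → sign (K [ e ]≔ inside) when b) (does-⇔ (toggle K) (P? _) (P? _)))
          (sym (trans (sym (when-neg _ (does (P? (K [ e ]≔ outside)))))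
                      (cong (_when does (P? (K [ e ]≔ outside))) (sign-toggle K))))
    where
    sign-toggle : ∀ K → - sign (K [ e ]≔ outside) ≡ sign (K [ e ]≔ inside)
    sign-toggle K = begin
      - sign (K [ e ]≔ outside)           ≡⟨ cong (λ m → - (-1ℤ ^ m)) (∣∁[e]≔outside∣ e K) ⟩
      - (-1ℤ * sign (K [ e ]≔ inside))    ≡⟨ cong -_ (ℤ.-1*i≡-i _) ⟩
      - - sign (K [ e ]≔ inside)          ≡⟨ ℤ.neg-involutive _ ⟩
      sign (K [ e ]≔ inside)              ∎
      where open ≡-Reasoning

-- Sums over all lists of length < N; the G-sequences are summed as an indicator over these.
∑ₗ : ℕ → (List (Subset n) → ℤ) → ℤ
∑ₗ zero    f = 0ℤ
∑ₗ (suc N) f = f [] + ∑ₛ λ K → ∑ₗ N (f ∘ (K ∷_))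

∑ₗ-cong : ∀ N {f g : List (Subset n) → ℤ} → (∀ L → f L ≡ g L) → ∑ₗ N f ≡ ∑ₗ N g
∑ₗ-cong zero    f≗g = refl
∑ₗ-cong (suc N) f≗g = cong₂ _+_ (f≗g []) (∑ₛ-cong λ K → ∑ₗ-cong N (f≗g ∘ (K ∷_)))

∑ₗ-zero : ∀ N → ∑ₗ {n} N (λ _ → 0ℤ) ≡ 0ℤ
∑ₗ-zero zero    = refl
∑ₗ-zero {n} (suc N) = trans (ℤ.+-identityˡ _) (trans (∑ₛ-cong {n} λ _ → ∑ₗ-zero N) (∑ₛ-zero {n}))

∑ₗ-+ : ∀ N (f g : List (Subset n) → ℤ) → ∑ₗ N (λ L → f L + g L) ≡ ∑ₗ N f + ∑ₗ N g
∑ₗ-+ zero    f g = refl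
∑ₗ-+ (suc N) f g = trans
  (cong (f [] + g [] +_) (trans (∑ₛ-cong λ K → ∑ₗ-+ N (f ∘ (K ∷_)) (g ∘ (K ∷_)))
                                (∑ₛ-+ (λ K → ∑ₗ N (f ∘ (K ∷_))) (λ K → ∑ₗ N (g ∘ (K ∷_))))))
  (interchange (f []) (g []) _ _)

∑ₗ-neg : ∀ N (f : List (Subset n) → ℤ) → ∑ₗ N (λ L → - f L) ≡ - ∑ₗ N f
∑ₗ-neg zero    f = refl
∑ₗ-neg (suc N) f = trans
  (cong (- f [] +_) (trans (∑ₛ-cong λ K → ∑ₗ-neg N (f ∘ (K ∷_))) (∑ₛ-neg (λ K → ∑ₗ N (f ∘ (K ∷_))))))
  (sym (ℤ.neg-distrib-+ (f []) _))

∑ₗ-when : ∀ N (b : Bool) (f : List (Subset n) → ℤ) → ∑ₗ N (λ L → f L when b) ≡ ∑ₗ N f when b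
∑ₗ-when N true  f = refl
∑ₗ-when N false f = ∑ₗ-zero N

∑ₗ-delta : ∀ N (M : List (Subset n)) (f : List (Subset n) → ℤ) → length M < N →
  ∑ₗ N (λ L → f L when does (L ≟ₗ M)) ≡ f M
∑ₗ-delta {n} (suc N) [] f _ =
  trans (cong (f [] +_) (trans (∑ₛ-cong {n} λ _ → ∑ₗ-zero N) (∑ₛ-zero {n}))) (ℤ.+-identityʳ (f []))
∑ₗ-delta (suc N) (K₀ ∷ M) f (s≤s |M|<N) = begin
  0ℤ + ∑ₛ (λ K → ∑ₗ N (λ L → f (K ∷ L) when (does (K ≟ₛ K₀) ∧ does (L ≟ₗ M))))
    ≡⟨ ℤ.+-identityˡ _ ⟩
  ∑ₛ (λ K → ∑ₗ N (λ L → f (K ∷ L) when (does (K ≟ₛ K₀) ∧ does (L ≟ₗ M))))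
    ≡⟨ ∑ₛ-cong (λ K → trans (∑ₗ-cong N λ L → when-∧ (f (K ∷ L)) (does (K ≟ₛ K₀)) (does (L ≟ₗ M)))
                                 (∑ₗ-when N (does (K ≟ₛ K₀)) λ L → f (K ∷ L) when does (L ≟ₗ M))) ⟩
  ∑ₛ (λ K → ∑ₗ N (λ L → f (K ∷ L) when does (L ≟ₗ M)) when does (K ≟ₛ K₀))
    ≡⟨ ∑ₛ-delta K₀ (λ K → ∑ₗ N (λ L → f (K ∷ L) when does (L ≟ₗ M))) ⟩
  ∑ₗ N (λ L → f (K₀ ∷ L) when does (L ≟ₗ M))
    ≡⟨ ∑ₗ-delta N M (f ∘ (K₀ ∷_)) |M|<N ⟩
  f (K₀ ∷ M) ∎
  where open ≡-Reasoning

module _ (f : List (Subset n) → ℤ) where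
  open import Data.List.Membership.DecPropositional (_≟ₗ_ {n}) using (_∈?_)

  sum-map≡∑ₗ : ∀ N (Ls : List (List (Subset n))) → Unique Ls → (∀ {L} → L ∈ Ls → length L < N) →
    sumℤ (map f Ls) ≡ ∑ₗ N (λ L → f L when does (L ∈? Ls))
  sum-map≡∑ₗ N []       _              _       = sym (∑ₗ-zero N)
  sum-map≡∑ₗ N (M ∷ Ls) uniq@(_ ∷ uniqLs) bounded = begin
    f M + sumℤ (map f Ls)
      ≡⟨ cong₂ _+_ (sym (∑ₗ-delta N M f (bounded (here refl)))) (sum-map≡∑ₗ N Ls uniqLs (bounded ∘ there)) ⟩
    ∑ₗ N (λ L → f L when does (L ≟ₗ M)) + ∑ₗ N (λ L → f L when does (L ∈? Ls))
      ≡⟨ sym (∑ₗ-+ N _ _) ⟩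
    ∑ₗ N (λ L → f L when does (L ≟ₗ M) + f L when does (L ∈? Ls))
      ≡⟨ ∑ₗ-cong N (λ L → when-∨ (f L) _ _ (disjoint L)) ⟩
    ∑ₗ N (λ L → f L when does (L ∈? M ∷ Ls)) ∎
    where
    open ≡-Reasoning
    disjoint : ∀ L → ¬ (does (L ≟ₗ M) ≡ true × does (L ∈? Ls) ≡ true)
    disjoint L _ with L ≟ₗ M | L ∈? Ls
    disjoint L (refl , refl) | yes refl | yes M∈Ls = Unique[x∷xs]⇒x∉xs uniq M∈Ls

module _ {r p} {_<_ : Rel (Fin n) r} (<-wellFounded : WellFounded _<_) (_<?_ : B.Decidable _<_)
         {P : Pred (Fin n) p} (P? : Decidable P) where

  minimal : ∀ {x} → P x → ∃ λ m → P m × ∀ {y} → y < m → ¬ P y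
  minimal {x} = go (<-wellFounded x)
    where
    go : ∀ {x} → Acc _<_ x → P x → ∃ λ m → P m × ∀ {y} → y < m → ¬ P y
    go {x} (acc smaller) Px with any? (λ y → (y <? x) ×-dec P? y)
    ... | yes (y , y<x , Py) = go (smaller y<x) Py
    ... | no ∄y              = x , Px , λ y<x Py → ∄y (_ , y<x , Py)

module _ {_≼_ : Rel (Fin n) 0ℓ} (≼-po : IsDecPartialOrder _≡_ _≼_) where
  open IsDecPartialOrder ≼-po using (isPartialOrder; _≤?_) renaming (refl to ≼-refl; trans to ≼-trans)
  open import Relation.Binary.Construct.NonStrictToStrict _≡_ _≼_ using (<-decidable) renaming (_<_ to _≺_)

  private
    _≺?_ : B.Decidable _≺_
    _≺?_ = <-decidable Fin._≟_ _≤?_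

  cover-above : ∀ {x y} → x ≺ y → ∃ λ w → Covers _≼_ x w × w ≼ y
  cover-above {x} {y} x≺y
    with minimal (po-wellFounded isPartialOrder) _≺?_ (λ v → (x ≺? v) ×-dec (v ≤? y)) (x≺y , ≼-refl)
  ... | w , ((x≼w , x≢w) , w≼y) , least = w , (x≼w , x≢w , between) , w≼y
    where
    between : ∀ z → x ≼ z → z ≼ w → z ≡ x ⊎ z ≡ w
    between z x≼z z≼w with z Fin.≟ x | z Fin.≟ w
    ... | yes z≡x | _       = inj₁ z≡x
    ... | no _    | yes z≡w = inj₂ z≡w
    ... | no z≢x  | no z≢w  = contradiction ((x≼z , z≢x ∘ sym) , ≼-trans z≼w w≼y) (least (z≼w , z≢w))

  cover-below : ∀ {x y} → x ≺ y → ∃ λ w → x ≼ w × Covers _≼_ w y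
  cover-below {x} {y} x≺y
    with minimal (po-noetherian isPartialOrder) (flip _≺?_) (λ v → (x ≤? v) ×-dec (v ≺? y)) (≼-refl , x≺y)
  ... | w , (x≼w , w≼y , w≢y) , greatest = w , x≼w , (w≼y , w≢y , between)
    where
    between : ∀ z → w ≼ z → z ≼ y → z ≡ w ⊎ z ≡ y
    between z w≼z z≼y with z Fin.≟ w | z Fin.≟ y
    ... | yes z≡w | _       = inj₁ z≡w
    ... | no _    | yes z≡y = inj₂ z≡y
    ... | no z≢w  | no z≢y  = contradiction (≼-trans x≼w w≼z , z≼y , z≢y) (greatest (w≼z , z≢w ∘ sym))

module _ {J K : Subset n} where

  ⊆∧≢⇒⊂ : J ⊆ K → K ≢ J → J ⊂ K
  ⊆∧≢⇒⊂ J⊆K K≢J with any? (λ x → (x ∈ₛ? K) ×-dec ¬? (x ∈ₛ? J))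
  ... | yes new = J⊆K , new
  ... | no ∄new = contradiction (⊆-antisym K⊆J J⊆K) K≢J
    where
    K⊆J : K ⊆ J
    K⊆J {x} x∈K = decidable-stable (x ∈ₛ? J) λ x∉J → ∄new (x , x∈K , x∉J)

  ⊂⇒≢ : J ⊂ K → K ≢ J
  ⊂⇒≢ (_ , x , x∈K , x∉J) refl = x∉J x∈K

  ⊂⇒∣∁∣> : J ⊂ K → ∣ ∁ K ∣ < ∣ ∁ J ∣
  ⊂⇒∣∁∣> = p⊂q⇒∣p∣<∣q∣ ∘ p⊂q⇒∁p⊃∁q

module _ (e : Fin n) (K : Subset n) where

  e∈[e]≔inside : e ∈ₛ K [ e ]≔ inside
  e∈[e]≔inside = Vec.[]≔-updates K e

  e∉[e]≔outside : e ∉ₛ K [ e ]≔ outside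
  e∉[e]≔outside e∈ with Vec.[]=-injective (Vec.[]≔-updates K e) e∈
  ... | ()

  ∈-[e]≔ : ∀ {x} b c → x ≢ e → x ∈ₛ K [ e ]≔ b → x ∈ₛ K [ e ]≔ c
  ∈-[e]≔ {x} b c x≢e x∈ = subst (x ∈ₛ_) (Vec.[]≔-idempotent K e) (Vec.[]≔-minimal (K [ e ]≔ b) x e x≢e x∈)

  [e]≔outside⊆[e]≔inside : K [ e ]≔ outside ⊆ K [ e ]≔ inside
  [e]≔outside⊆[e]≔inside {x} x∈ with x Fin.≟ e
  ... | yes refl = e∈[e]≔inside
  ... | no x≢e   = ∈-[e]≔ outside inside x≢e x∈

module GSequences {_≼_ : Rel (Fin n) 0ℓ} (≼-po : IsDecPartialOrder _≡_ _≼_)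
                  {G : Fin n → Fin n → Set} (G? : ∀ x y → Dec (G x y))
                  (G⊆covers : GSubCovers _≼_ G) (acyclic : IsAcyclic _≼_ G) where

  open IsDecPartialOrder ≼-po using (_≤?_)

  _⋖_ : Fin n → Fin n → Set
  _⋖_ = Covers _≼_

  Ideal : Subset n → Set
  Ideal = IsOrderIdeal _≼_

  Step : Subset n → Subset n → Set
  Step = GStep _≼_ G

  GBetween : Subset n → Subset n → Set
  GBetween J K = ∀ x y → x ∈ₛ K → x ∉ₛ J → y ∈ₛ K → y ∉ₛ J → x ⋖ y → G x y

  GFree : Subset n → Set
  GFree K = ∀ x y → x ∉ₛ K → y ∉ₛ K → ¬ G x y

  FreeStep : Subset n → Subset n → Set
  FreeStep J K = Step J K × Ideal K × GFree K

  FreeExtension : Subset n → Subset n → Set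
  FreeExtension J K = Ideal K × J ⊆ K × GBetween J K × GFree K

  _⋖?_ : ∀ x y → Dec (x ⋖ y)
  x ⋖? y = (x ≤? y) ×-dec ¬? (x Fin.≟ y) ×-dec
           all? (λ z → (x ≤? z) →-dec (z ≤? y) →-dec ((z Fin.≟ x) ⊎-dec (z Fin.≟ y)))

  ideal? : Decidable Ideal
  ideal? K = all? λ x → all? λ y → (y ∈ₛ? K) →-dec (x ≤? y) →-dec (x ∈ₛ? K)

  between? : ∀ J K → Dec (GBetween J K)
  between? J K = all? λ x → all? λ y →
    (x ∈ₛ? K) →-dec ¬? (x ∈ₛ? J) →-dec (y ∈ₛ? K) →-dec ¬? (y ∈ₛ? J) →-dec (x ⋖? y) →-dec G? x y

  free? : Decidable GFree
  free? K = all? λ x → all? λ y → ¬? (x ∈ₛ? K) →-dec ¬? (y ∈ₛ? K) →-dec ¬? (G? x y)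

  step? : ∀ J K → Dec (Step J K)
  step? J K = ((J ⊆? K) ×-dec any? (λ x → (x ∈ₛ? K) ×-dec ¬? (x ∈ₛ? J))) ×-dec between? J K

  freeStep? : ∀ J K → Dec (FreeStep J K)
  freeStep? J K = step? J K ×-dec ideal? K ×-dec free? K

  freeExtension? : ∀ J K → Dec (FreeExtension J K)
  freeExtension? J K = ideal? K ×-dec (J ⊆? K) ×-dec between? J K ×-dec free? K

  between-⊆ : ∀ {J K K′} → K ⊆ K′ → GBetween J K′ → GBetween J K
  between-⊆ K⊆K′ between x y x∈K x∉J y∈K y∉J = between x y (K⊆K′ x∈K) x∉J (K⊆K′ y∈K) y∉J

  free-⊆ : ∀ {K K′} → K ⊆ K′ → GFree K → GFree K′
  free-⊆ K⊆K′ free x y x∉K′ y∉K′ = free x y (x∉K′ ∘ K⊆K′) (y∉K′ ∘ K⊆K′)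

  module _ {J : Subset n} (J-ideal : Ideal J) {e : Fin n} (e∉J : e ∉ₛ J)
           (no-G-from-e : ∀ {w} → w ∉ₛ J → ¬ G e w)
           (G-into-e : ∀ {x} → x ∉ₛ J → x ⋖ e → G x e) (K : Subset n) where

    private
      Kᵢ Kₒ : Subset n
      Kᵢ = K [ e ]≔ inside
      Kₒ = K [ e ]≔ outside

      Kₒ⊆Kᵢ : Kₒ ⊆ Kᵢ
      Kₒ⊆Kᵢ = [e]≔outside⊆[e]≔inside e K

      ∈Kᵢ⇒∈Kₒ : ∀ {x} → x ≢ e → x ∈ₛ Kᵢ → x ∈ₛ Kₒ
      ∈Kᵢ⇒∈Kₒ = ∈-[e]≔ e K inside outside

      ∈J⇒≢e : ∀ {x} → x ∈ₛ J → x ≢ e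
      ∈J⇒≢e x∈J refl = e∉J x∈J

      e∈Kᵢ : e ∈ₛ Kᵢ
      e∈Kᵢ = e∈[e]≔inside e K

      e∉Kₒ : e ∉ₛ Kₒ
      e∉Kₒ = e∉[e]≔outside e K

    ideal-remove : Ideal Kᵢ → GBetween J Kᵢ → Ideal Kₒ
    ideal-remove Kᵢ-ideal between x y y∈Kₒ x≼y with x Fin.≟ e
    ... | no x≢e   = ∈Kᵢ⇒∈Kₒ x≢e (Kᵢ-ideal x y (Kₒ⊆Kᵢ y∈Kₒ) x≼y)
    ... | yes refl with cover-above ≼-po (x≼y , λ { refl → e∉Kₒ y∈Kₒ })
    ...   | w , e⋖w , w≼y = contradiction (between e w e∈Kᵢ e∉J w∈Kᵢ w∉J e⋖w) (no-G-from-e w∉J)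
      where
      w∈Kᵢ : w ∈ₛ Kᵢ
      w∈Kᵢ = Kᵢ-ideal w y (Kₒ⊆Kᵢ y∈Kₒ) w≼y
      w∉J : w ∉ₛ J
      w∉J w∈J = e∉J (J-ideal e w w∈J (proj₁ e⋖w))

    ideal-insert : Ideal Kₒ → J ⊆ Kₒ → GFree Kₒ → Ideal Kᵢ
    ideal-insert Kₒ-ideal J⊆Kₒ Kₒ-free x y y∈Kᵢ x≼y with y Fin.≟ e | x Fin.≟ e
    ... | no y≢e   | _        = Kₒ⊆Kᵢ (Kₒ-ideal x y (∈Kᵢ⇒∈Kₒ y≢e y∈Kᵢ) x≼y)
    ... | yes refl | yes refl = e∈Kᵢ
    ... | yes refl | no x≢e with cover-below ≼-po (x≼y , x≢e)
    ...   | v , x≼v , v⋖e = Kₒ⊆Kᵢ (Kₒ-ideal x v v∈Kₒ x≼v)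
      where
      v∈Kₒ : v ∈ₛ Kₒ
      v∈Kₒ = decidable-stable (v ∈ₛ? Kₒ) λ v∉Kₒ →
        Kₒ-free v e v∉Kₒ e∉Kₒ (G-into-e (v∉Kₒ ∘ J⊆Kₒ) v⋖e)

    between-insert : Ideal Kₒ → GBetween J Kₒ → GBetween J Kᵢ
    between-insert Kₒ-ideal between x y x∈Kᵢ x∉J y∈Kᵢ y∉J x⋖y with y Fin.≟ e | x Fin.≟ e
    ... | yes refl | _        = G-into-e x∉J x⋖y
    ... | no y≢e   | yes refl = contradiction (Kₒ-ideal e y (∈Kᵢ⇒∈Kₒ y≢e y∈Kᵢ) (proj₁ x⋖y)) e∉Kₒ
    ... | no y≢e   | no x≢e   = between x y (∈Kᵢ⇒∈Kₒ x≢e x∈Kᵢ) x∉J (∈Kᵢ⇒∈Kₒ y≢e y∈Kᵢ) y∉J x⋖y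

    free-remove : Ideal Kᵢ → GFree Kᵢ → GFree Kₒ
    free-remove Kᵢ-ideal Kᵢ-free x y x∉Kₒ y∉Kₒ Gxy with x Fin.≟ e | y Fin.≟ e
    ... | yes refl | _        = no-G-from-e (λ y∈J → e∉J (J-ideal e y y∈J (proj₁ (G⊆covers e y Gxy)))) Gxy
    ... | no x≢e   | yes refl = x∉Kₒ (∈Kᵢ⇒∈Kₒ x≢e (Kᵢ-ideal x e e∈Kᵢ (proj₁ (G⊆covers x e Gxy))))
    ... | no x≢e   | no y≢e   = Kᵢ-free x y (x∉Kₒ ∘ ∈Kᵢ⇒∈Kₒ x≢e) (y∉Kₒ ∘ ∈Kᵢ⇒∈Kₒ y≢e) Gxy

    freeExtension-toggle : FreeExtension J Kᵢ ⇔ FreeExtension J Kₒ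
    freeExtension-toggle = mk⇔
      (λ (Kᵢ-ideal , J⊆Kᵢ , between , free) →
        ideal-remove Kᵢ-ideal between , (λ x∈J → ∈Kᵢ⇒∈Kₒ (∈J⇒≢e x∈J) (J⊆Kᵢ x∈J)) ,
        between-⊆ Kₒ⊆Kᵢ between , free-remove Kᵢ-ideal free)
      (λ (Kₒ-ideal , J⊆Kₒ , between , free) →
        ideal-insert Kₒ-ideal J⊆Kₒ free , Kₒ⊆Kᵢ ∘ J⊆Kₒ ,
        between-insert Kₒ-ideal between , free-⊆ Kₒ⊆Kᵢ free)

  edge? : ∀ u v → Dec (Edge _≼_ G u v)
  edge? u v = G? u v ⊎-dec ((v ⋖? u) ×-dec ¬? (G? v u))

  edge-noetherian : WellFounded (flip (Edge _≼_ G))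
  edge-noetherian = Subrelation.wellFounded [_] (spo-noetherian edge⁺-isStrictPartialOrder)
    where
    edge⁺-isStrictPartialOrder : IsStrictPartialOrder _≡_ (TransClosure (Edge _≼_ G))
    edge⁺-isStrictPartialOrder = record
      { isEquivalence = isEquivalence
      ; irrefl        = λ { refl → acyclic _ }
      ; trans         = _++_
      ; <-resp-≈      = resp₂ _
      }

  sink-outside : ∀ {J} → J ≢ ⊤ →
    ∃ λ e → e ∉ₛ J × (∀ {w} → w ∉ₛ J → ¬ G e w) × (∀ {x} → x ∉ₛ J → x ⋖ e → G x e)
  sink-outside {J} J≢⊤ with ⊆∧≢⇒⊂ ⊆⊤ (J≢⊤ ∘ sym)
  ... | _ , x , _ , x∉J with minimal edge-noetherian (flip edge?) (λ v → ¬? (v ∈ₛ? J)) x∉J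
  ...   | e , e∉J , sink =
    e , e∉J , (λ w∉J Gew → sink (inj₁ Gew) w∉J) ,
    λ {x} x∉J x⋖e → decidable-stable (G? x e) λ ¬Gxe → sink (inj₂ (x⋖e , ¬Gxe)) x∉J

  freeStep⇔ : ∀ {J K} → FreeStep J K ⇔ (K ≢ J × FreeExtension J K)
  freeStep⇔ = mk⇔
    (λ ((J⊂K , between) , K-ideal , free) → ⊂⇒≢ J⊂K , K-ideal , proj₁ J⊂K , between , free)
    (λ (K≢J , K-ideal , J⊆K , between , free) → (⊆∧≢⇒⊂ J⊆K K≢J , between) , K-ideal , free)

  signedCount-freeStep : ∀ {J} → Ideal J →
    1ℤ when does (J ≟ₛ ⊤) - signedCount (freeStep? J) ≡ sign J when does (free? J)
  signedCount-freeStep {J} J-ideal with J ≟ₛ ⊤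
  ... | yes refl = begin
    1ℤ - signedCount (freeStep? ⊤) ≡⟨ cong (λ c → 1ℤ - c) no-freeStep ⟩
    1ℤ                             ≡⟨ cong (-1ℤ ^_) (∣∁⊤∣≡0 n) ⟨
    sign (⊤ {n})                   ≡⟨ cong (λ b → sign (⊤ {n}) when b) (dec-true (free? ⊤) ⊤-free) ⟨
    sign (⊤ {n}) when does (free? ⊤) ∎
    where
    open ≡-Reasoning
    ⊤-free : GFree ⊤
    ⊤-free x _ x∉⊤ = contradiction ∈⊤ x∉⊤
    no-freeStep : signedCount (freeStep? ⊤) ≡ 0ℤ
    no-freeStep = trans (∑ₛ-cong λ K → cong (λ b → sign K when b)
                          (dec-false (freeStep? ⊤ K) λ (((_ , x , _ , x∉⊤) , _) , _) → x∉⊤ ∈⊤))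
                        (∑ₛ-zero {n})
  ... | no J≢⊤ with sink-outside J≢⊤
  ...   | e , e∉J , no-G-from-e , G-into-e = minus-from-sum (begin
    sign J when does (free? J) + signedCount (freeStep? J)
      ≡⟨ cong₂ _+_ (cong (λ b → sign J when b) (does-⇔ J-free⇔ (free? J) (freeExtension? J J)))
                   (signedCount-cong (freeStep? J) (λ K → ¬? (K ≟ₛ J) ×-dec freeExtension? J K)
                                     (λ K → freeStep⇔)) ⟩
    sign J when does (freeExtension? J J) + signedCount (λ K → ¬? (K ≟ₛ J) ×-dec freeExtension? J K)
      ≡⟨ signedCount-extract (freeExtension? J) J ⟨
    signedCount (freeExtension? J)
      ≡⟨ signedCount-toggle (freeExtension? J) e (freeExtension-toggle J-ideal e∉J no-G-from-e G-into-e) ⟩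
    0ℤ ∎)
    where
    open ≡-Reasoning
    J-free⇔ : GFree J ⇔ FreeExtension J J
    J-free⇔ = mk⇔ (λ free → J-ideal , (λ {x} x∈J → x∈J) , (λ _ _ x∈J x∉J → contradiction x∈J x∉J) , free)
                  (proj₂ ∘ proj₂ ∘ proj₂)
    minus-from-sum : ∀ {a c} → a + c ≡ 0ℤ → 0ℤ - c ≡ a
    minus-from-sum {a} {c} a+c≡0 = begin
      0ℤ - c       ≡⟨ cong (λ x → x - c) a+c≡0 ⟨
      a + c - c    ≡⟨ ℤ.+-assoc a c (- c) ⟩
      a + (c - c)  ≡⟨ cong (a +_) (ℤ.+-inverseʳ c) ⟩
      a + 0ℤ       ≡⟨ ℤ.+-identityʳ a ⟩
      a            ∎

  Chain : Subset n → List (Subset n) → Set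
  Chain J []      = Ideal J × J ≡ ⊤
  Chain J (K ∷ L) = Ideal J × Step J K × Chain K L

  chain? : ∀ J L → Dec (Chain J L)
  chain? J []      = ideal? J ×-dec (J ≟ₛ ⊤)
  chain? J (K ∷ L) = ideal? J ×-dec step? J K ×-dec chain? K L

  chain⇒ideal : ∀ {J} L → Chain J L → Ideal J
  chain⇒ideal []      = proj₁
  chain⇒ideal (_ ∷ _) = proj₁

  chain-length : ∀ {J} L → Chain J L → length L ≤ ∣ ∁ J ∣
  chain-length []      _                        = z≤n
  chain-length (K ∷ L) (_ , (J⊂K , _) , chain) = ℕ.≤-trans (s≤s (chain-length L chain)) (⊂⇒∣∁∣> J⊂K)

  chain⇔ : ∀ K L → Chain K L ⇔ (last (K ∷ L) ≡ just ⊤ × All Ideal (K ∷ L) × Linked Step (K ∷ L))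
  chain⇔ K L = mk⇔ (to K L) (from K L)
    where
    to : ∀ K L → Chain K L → last (K ∷ L) ≡ just ⊤ × All Ideal (K ∷ L) × Linked Step (K ∷ L)
    to K []       (K-ideal , refl)        = refl , K-ideal ∷ [] , [-]
    to K (K′ ∷ L) (K-ideal , step , chain) with to K′ L chain
    ... | ends-at-⊤ , ideals , steps = ends-at-⊤ , K-ideal ∷ ideals , step ∷ steps
    from : ∀ K L → last (K ∷ L) ≡ just ⊤ × All Ideal (K ∷ L) × Linked Step (K ∷ L) → Chain K L
    from K []       (ends-at-⊤ , K-ideal ∷ [] , _)              = K-ideal , just-injective ends-at-⊤
    from K (K′ ∷ L) (ends-at-⊤ , K-ideal ∷ ideals , step ∷ steps) =
      K-ideal , step , from K′ L (ends-at-⊤ , ideals , steps)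

  gSequence⇔ : ∀ K L → IsGSequence _≼_ G (K ∷ L) ⇔ (K ≡ ⊥ × Chain K L)
  gSequence⇔ K L = mk⇔
    (λ (starts-at-⊥ , rest) → just-injective starts-at-⊥ , Equivalence.from (chain⇔ K L) rest)
    (λ (K≡⊥ , chain) → cong just K≡⊥ , Equivalence.to (chain⇔ K L) chain)

  gSequence? : Decidable (IsGSequence _≼_ G)
  gSequence? []      = no λ ()
  gSequence? (K ∷ L) = Dec.map (⇔.sym (gSequence⇔ K L)) ((K ≟ₛ ⊥) ×-dec chain? K L)

  chainSum : ℕ → Subset n → ℤ
  chainSum N J = ∑ₗ N λ L → -1ℤ ^ length L when does (chain? J L)

  chainSum-nonIdeal : ∀ N {J} → ¬ Ideal J → chainSum N J ≡ 0ℤ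
  chainSum-nonIdeal N {J} ¬J-ideal = trans
    (∑ₗ-cong N λ L → cong (λ b → -1ℤ ^ length L when b) (dec-false (chain? J L) (¬J-ideal ∘ chain⇒ideal L)))
    (∑ₗ-zero N)

  chainSum-suc : ∀ N {J} → Ideal J →
    chainSum (suc N) J ≡ 1ℤ when does (J ≟ₛ ⊤) - ∑ₛ (λ K → chainSum N K when does (step? J K))
  chainSum-suc N {J} J-ideal = cong₂ _+_
    (cong (λ b → 1ℤ when (b ∧ does (J ≟ₛ ⊤))) J-ideal?)
    (trans (∑ₛ-cong extend) (∑ₛ-neg λ K → chainSum N K when does (step? J K)))
    where
    J-ideal? : does (ideal? J) ≡ true
    J-ideal? = dec-true (ideal? J) J-ideal
    extend : ∀ K → ∑ₗ N (λ L → -1ℤ ^ suc (length L) when does (chain? J (K ∷ L)))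
                 ≡ - (chainSum N K when does (step? J K))
    extend K = begin
      ∑ₗ N (λ L → -1ℤ ^ suc (length L) when (does (ideal? J) ∧ (does (step? J K) ∧ does (chain? K L))))
        ≡⟨ ∑ₗ-cong N (λ L → cong (λ b → -1ℤ ^ suc (length L) when (b ∧ (does (step? J K) ∧ does (chain? K L))))
                                  J-ideal?) ⟩
      ∑ₗ N (λ L → -1ℤ ^ suc (length L) when (does (step? J K) ∧ does (chain? K L)))
        ≡⟨ ∑ₗ-cong N (λ L → when-∧ (-1ℤ ^ suc (length L)) (does (step? J K)) (does (chain? K L))) ⟩
      ∑ₗ N (λ L → -1ℤ ^ suc (length L) when does (chain? K L) when does (step? J K))
        ≡⟨ ∑ₗ-when N (does (step? J K)) (λ L → -1ℤ ^ suc (length L) when does (chain? K L)) ⟩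
      ∑ₗ N (λ L → -1ℤ ^ suc (length L) when does (chain? K L)) when does (step? J K)
        ≡⟨ cong (_when does (step? J K)) (trans (∑ₗ-cong N flip-sign) (∑ₗ-neg N _)) ⟩
      - chainSum N K when does (step? J K)
        ≡⟨ when-neg (chainSum N K) (does (step? J K)) ⟩
      - (chainSum N K when does (step? J K)) ∎
      where
      open ≡-Reasoning
      flip-sign : ∀ L → -1ℤ ^ suc (length L) when does (chain? K L)
                      ≡ - (-1ℤ ^ length L when does (chain? K L))
      flip-sign L = trans (cong (_when does (chain? K L)) (ℤ.-1*i≡-i (-1ℤ ^ length L)))
                          (when-neg (-1ℤ ^ length L) (does (chain? K L)))

  chainSum-closedForm : ∀ N {J} → Ideal J → ∣ ∁ J ∣ < N → chainSum N J ≡ sign J when does (free? J)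
  chainSum-closedForm (suc N) {J} J-ideal (s≤s ∣∁J∣≤N) = begin
    chainSum (suc N) J
      ≡⟨ chainSum-suc N J-ideal ⟩
    1ℤ when does (J ≟ₛ ⊤) - ∑ₛ (λ K → chainSum N K when does (step? J K))
      ≡⟨ cong (λ s → 1ℤ when does (J ≟ₛ ⊤) - s) (∑ₛ-cong λ K → by-induction K (step? J K) (ideal? K)) ⟩
    1ℤ when does (J ≟ₛ ⊤) - signedCount (freeStep? J)
      ≡⟨ signedCount-freeStep J-ideal ⟩
    sign J when does (free? J) ∎
    where
    open ≡-Reasoning
    by-induction : ∀ K (step : Dec (Step J K)) (K-ideal? : Dec (Ideal K)) →
      chainSum N K when does step ≡ sign K when does (step ×-dec K-ideal? ×-dec free? K)
    by-induction K (no _)    _               = refl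
    by-induction K (yes _)   (no ¬K-ideal)   = chainSum-nonIdeal N ¬K-ideal
    by-induction K (yes J⊂K) (yes K-ideal)   =
      chainSum-closedForm N K-ideal (ℕ.<-≤-trans (⊂⇒∣∁∣> (proj₁ J⊂K)) ∣∁J∣≤N)

  gSequence-length : ∀ L → IsGSequence _≼_ G L → length L < suc (suc n)
  gSequence-length (K ∷ L) gSequence with Equivalence.to (gSequence⇔ K L) gSequence
  ... | refl , chain = s≤s (s≤s (subst (length L ≤_) (∣∁⊥∣≡n n) (chain-length L chain)))

  open import Data.List.Membership.DecPropositional (_≟ₗ_ {n}) using (_∈?_)

  signedSum-closedForm : (Ls : List (List (Subset n))) → Unique Ls → (∀ L → (L ∈ Ls) ⇔ IsGSequence _≼_ G L) →
    signedSum Ls ≡ sign (⊥ {n}) when does (free? ⊥)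
  signedSum-closedForm Ls uniq Ls⇔ = begin
    signedSum Ls
      ≡⟨ sum-map≡∑ₗ sgn (suc (suc n)) Ls uniq
                    (λ {L} L∈Ls → gSequence-length L (Equivalence.to (Ls⇔ L) L∈Ls)) ⟩
    ∑ₗ (suc (suc n)) (λ L → sgn L when does (L ∈? Ls))
      ≡⟨ ∑ₗ-cong (suc (suc n)) (λ L → cong (λ b → sgn L when b) (does-⇔ (Ls⇔ L) (L ∈? Ls) (gSequence? L))) ⟩
    0ℤ + ∑ₛ (λ K → ∑ₗ (suc n) λ L → -1ℤ ^ length L when (does (K ≟ₛ ⊥) ∧ does (chain? K L)))
      ≡⟨ ℤ.+-identityˡ _ ⟩
    ∑ₛ (λ K → ∑ₗ (suc n) λ L → -1ℤ ^ length L when (does (K ≟ₛ ⊥) ∧ does (chain? K L)))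
      ≡⟨ ∑ₛ-cong (λ K → trans (∑ₗ-cong (suc n) λ L → when-∧ (-1ℤ ^ length L) (does (K ≟ₛ ⊥)) (does (chain? K L)))
                              (∑ₗ-when (suc n) (does (K ≟ₛ ⊥)) λ L → -1ℤ ^ length L when does (chain? K L))) ⟩
    ∑ₛ (λ K → chainSum (suc n) K when does (K ≟ₛ ⊥))
      ≡⟨ ∑ₛ-delta ⊥ (chainSum (suc n)) ⟩
    chainSum (suc n) ⊥
      ≡⟨ chainSum-closedForm (suc n) (λ _ _ y∈⊥ _ → contradiction y∈⊥ ∉⊥) (ℕ.≤-reflexive (cong suc (∣∁⊥∣≡n n))) ⟩
    sign (⊥ {n}) when does (free? ⊥) ∎
    where
    open ≡-Reasoning
    sgn : List (Subset n) → ℤ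
    sgn L = -1ℤ ^ seqLength L

lemma3p18 : (n : ℕ) (_≼_ : Rel (Fin n) 0ℓ) → IsDecPartialOrder _≡_ _≼_
    → (G : Fin n → Fin n → Set) → (∀ x y → Dec (G x y))
    → GSubCovers _≼_ G → IsAcyclic _≼_ G
    → (Ls : List (List (Subset n))) → Unique Ls
    → (∀ L → (L ∈ Ls) ⇔ IsGSequence _≼_ G L)
    → ((∀ x y → ¬ G x y) → signedSum Ls ≡ -1ℤ ^ n)
      × (¬ (∀ x y → ¬ G x y) → signedSum Ls ≡ 0ℤ)
lemma3p18 n _≼_ ≼-po G G? G⊆covers acyclic Ls uniq Ls⇔ =
  (λ no-G → begin
    signedSum Ls                     ≡⟨ signedSum-closedForm Ls uniq Ls⇔ ⟩
    sign (⊥ {n}) when does (free? ⊥) ≡⟨ cong (λ b → sign (⊥ {n}) when b) (dec-true (free? ⊥) λ x y _ _ → no-G x y) ⟩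
    sign (⊥ {n})                     ≡⟨ cong (-1ℤ ^_) (∣∁⊥∣≡n n) ⟩
    -1ℤ ^ n                          ∎) ,
  (λ some-G → trans (signedSum-closedForm Ls uniq Ls⇔)
    (cong (λ b → sign (⊥ {n}) when b) (dec-false (free? ⊥) λ ⊥-free → some-G λ x y → ⊥-free x y ∉⊥ ∉⊥)))
  where
  open GSequences ≼-po G? G⊆covers acyclic
  open ≡-Reasoning
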